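{- In the formal system described in the context (Leśniewski's ontology and mereology extended with Tarski's primitive name "balls" and the defined name "solids"), the following holds: for all names $A, B : N$, if $A \,\varepsilon\, \mathrm{solids}$ and $B \,\varepsilon\, \mathrm{el}\,A$, then $B \,\varepsilon\, \mathrm{solids}$.
   Context: The setting is a higher-order (Coq-style, intuitionistic) theory with a type $N$ of names and a primitive binary predicate $\varepsilon : N \to N \to \mathrm{Prop}$ (written $A \,\varepsilon\, a$). All variables below range over $N$. Axioms and definitions: (Ontology axiom) $\forall A\,a,\ A\,\varepsilon\,a \leftrightarrow \big((\exists B,\ B\,\varepsilon\,A) \wedge (\forall C\,D,\ (C\,\varepsilon\,A \wedge D\,\varepsilon\,A) \to C\,\varepsilon\,D) \wedge (\forall C,\ C\,\varepsilon\,A \to C\,\varepsilon\,a)\big)$. (Singular equality) a predicate $\mathrm{singular\_equality} : N\to N\to\mathrm{Prop}$ with $\mathrm{singular\_equality}\,A\,B \leftrightarrow (A\,\varepsilon\,B \wedge B\,\varepsilon\,A)$. (Name-forming functors) $\mathrm{pt}, \mathrm{el}, \mathrm{Kl}, \mathrm{coll}, \mathrm{subcoll}, \mathrm{distinct} : N \to N$ ("part of", "element of", "class of", "collection of", "subcollection of", "different from"). (A1) $\forall A\,B,\ A\,\varepsilon\,\mathrm{pt}\,B \to B\,\varepsilon\,\mathrm{distinct}(\mathrm{pt}\,A)$. (A2) the relation $(A,B)\mapsto A\,\varepsilon\,\mathrm{pt}\,B$ is transitive. (MD1) $\forall A\,B,\ A\,\varepsilon\,\mathrm{el}\,B \leftrightarrow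 \big(A\,\varepsilon\,A \wedge (\mathrm{singular\_equality}\,A\,B \vee A\,\varepsilon\,\mathrm{pt}\,B)\big)$. (MD2) $\forall A\,a,\ A\,\varepsilon\,\mathrm{Kl}\,a \leftrightarrow \big(A\,\varepsilon\,A \wedge (\exists B,\ B\,\varepsilon\,a) \wedge (\forall B,\ B\,\varepsilon\,a \to B\,\varepsilon\,\mathrm{el}\,A) \wedge (\forall B,\ B\,\varepsilon\,\mathrm{el}\,A \to \exists C\,D,\ C\,\varepsilon\,a \wedge D\,\varepsilon\,\mathrm{el}\,C \wedge D\,\varepsilon\,\mathrm{el}\,B)\big)$. (A3) $\forall A\,B\,a,\ (A\,\varepsilon\,\mathrm{Kl}\,a \wedge B\,\varepsilon\,\mathrm{Kl}\,a) \to \mathrm{singular\_equality}\,A\,B$. (A4) $\forall A\,a,\ A\,\varepsilon\,a \to \exists B,\ B\,\varepsilon\,\mathrm{Kl}\,a$. (MD3) $\forall P\,a,\ P\,\varepsilon\,\mathrm{coll}\,a \leftrightarrow \big(P\,\varepsilon\,P \wedge \forall Q,\ Q\,\varepsilon\,\mathrm{el}\,P \to \exists C\,D,\ C\,\varepsilon\,a \wedge C\,\varepsilon\,\mathrm{el}\,P \wedge D\,\varepsilon\,\mathrm{el}\,C \wedge D\,\varepsilon\,\mathrm{el}\,Q\big)$. (Subcollection) the functor $\mathrm{subcoll}$ satisfies $\forall A\,B,\ B\,\varepsilon\,\mathrm{el}\,A \leftrightarrow B\,\varepsilon\,\mathrm{subcoll}\,A$. (Mereogeometry) $\mathrm{balls}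 : N$ is a primitive constant name; $\mathrm{solids} : N$ is a constant name satisfying $\forall A,\ A\,\varepsilon\,\mathrm{solids} \leftrightarrow \exists B,\ \big(B\,\varepsilon\,B \wedge B\,\varepsilon\,\mathrm{coll}\,\mathrm{balls} \wedge A\,\varepsilon\,\mathrm{subcoll}\,B\big)$. -}

module Defs where

open import Level using (Level; suc; _⊔_)
open import Data.Product using (Σ; ∃; ∃-syntax; _×_; _,_)
open import Data.Sum using (_⊎_)
open import Function.Bundles using (_⇔_)

record Theory (ℓ ℓ' : Level) : Set (suc (ℓ ⊔ ℓ')) where
  field
    N : Set ℓ
    _ε_ : N → N → Set ℓ'

    ontology : ∀ A a → (A ε a) ⇔
      ((∃[ B ] (B ε A)) ×
       (∀ C D → (C ε A × D ε A) → C ε D) ×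
       (∀ C → C ε A → C ε a))

    singular-equality : N → N → Set ℓ'
    singular-equality-def : ∀ A B → singular-equality A B ⇔ (A ε B × B ε A)

    pt el Kl coll subcoll distinct : N → N

    A1 : ∀ A B → A ε pt B → B ε distinct (pt A)
    A2 : ∀ A B C → A ε pt B → B ε pt C → A ε pt C

    MD1 : ∀ A B → (A ε el B) ⇔ (A ε A × (singular-equality A B ⊎ A ε pt B))

    MD2 : ∀ A a → (A ε Kl a) ⇔
      (A ε A ×
       (∃[ B ] (B ε a)) ×
       (∀ B → B ε a → B ε el A) ×
       (∀ B → B ε el A → ∃[ C ] ∃[ D ] (C ε a × D ε el C × D ε el B)))

    A3 : ∀ A B a → (A ε Kl a × B ε Kl a) → singular-equality A B
    A4 : ∀ A a → A ε a → ∃[ B ] (B ε Kl a)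

    MD3 : ∀ P a → (P ε coll a) ⇔
      (P ε P ×
       (∀ Q → Q ε el P →
         ∃[ C ] ∃[ D ] (C ε a × C ε el P × D ε el C × D ε el Q)))

    subcoll-def : ∀ A B → (B ε el A) ⇔ (B ε subcoll A)

    balls solids : N
    solids-def : ∀ A → (A ε solids) ⇔
      (∃[ B ] (B ε B × B ε coll balls × A ε subcoll B))

{-# OPTIONS --safe #-}
module Submission where

open import Defs
open import Level using (Level)
open import Data.Product using (∃-syntax; _×_; _,_; proj₁; proj₂)
open import Data.Sum using (inj₁; inj₂)
open import Function.Bundles using (Equivalence)
open Equivalence using (to; from)

-- A solid A is an element of some collection P of balls.  For B an element
-- of A, either A is a part of P, and then B is an element of P by transitivity
-- of parthood, or A is P itself, and then A is a collection of balls of which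
-- B is an element.  The second case has to be handled by changing the witness
-- from P to A, since no axiom makes el extensional.

module Mereology {ℓ ℓ' : Level} (T : Theory ℓ ℓ') where
  open Theory T

  ε-trans : ∀ {A B a} → B ε A → A ε a → B ε a
  ε-trans {A} {B} {a} B∈A A∈a = proj₂ (proj₂ (to (ontology A a) A∈a)) B B∈A

  singular-equality⇒ε : ∀ {A B} → singular-equality A B → A ε B
  singular-equality⇒ε {A} {B} A≡B = proj₁ (to (singular-equality-def A B) A≡B)

  el-pt-trans : ∀ {A B P} → B ε el A → A ε pt P → B ε el P
  el-pt-trans {A} {B} {P} B∈elA A∈ptP with to (MD1 B A) B∈elA
  ... | B∈B , inj₁ B≡A   = from (MD1 B P) (B∈B , inj₂ (ε-trans (singular-equality⇒ε B≡A) A∈ptP))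
  ... | B∈B , inj₂ B∈ptA = from (MD1 B P) (B∈B , inj₂ (A2 B A P B∈ptA A∈ptP))

  solid-intro : ∀ {A P} → P ε P → P ε coll balls → A ε el P → A ε solids
  solid-intro {A} {P} P∈P P∈coll A∈elP =
    from (solids-def A) (P , P∈P , P∈coll , to (subcoll-def P A) A∈elP)

  solid-elim : ∀ {A} → A ε solids → ∃[ P ] (P ε P × P ε coll balls × A ε el P)
  solid-elim {A} A∈solids with to (solids-def A) A∈solids
  ... | P , P∈P , P∈coll , A∈subcollP = P , P∈P , P∈coll , from (subcoll-def P A) A∈subcollP

  el-of-solid-solid : ∀ {A B} → A ε solids → B ε el A → B ε solids
  el-of-solid-solid {A} A∈solids B∈elA with solid-elim A∈solids
  ... | P , P∈P , P∈coll , A∈elP with to (MD1 A P) A∈elP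
  ...   | A∈A , inj₁ A≡P   = solid-intro A∈A (ε-trans (singular-equality⇒ε A≡P) P∈coll) B∈elA
  ...   | _   , inj₂ A∈ptP = solid-intro P∈P P∈coll (el-pt-trans B∈elA A∈ptP)

mainTheorem2 : ∀ {ℓ ℓ'} (T : Theory ℓ ℓ') → let open Theory T in
    ∀ A B → A ε solids → B ε el A → B ε solids
mainTheorem2 T A B = Mereology.el-of-solid-solid T
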